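{- Let $M$ be a regular matroid on $E$, let $e,f\in E$ be distinct, let $\vec C$ be a signed circuit, $\vec C^*$ a signed cocircuit and $\vec F$ a fourientation of $M$. Suppose $e\in C\cap C^*$, $(\vec C\setminus f)\sim\vec F$ and $(\vec C^*\setminus f)\sim(-\vec F)^c$. Then $C\cap C^*=\{e,f\}$.
   Context: $M=M(A)$ is represented by a real totally unimodular matrix $A$ of full row rank with columns indexed by $E$ (circuits: minimal sets in no basis; cocircuits: minimal sets meeting every basis). A signed circuit (cocircuit) is an element of $\ker A$ (row space of $A$) with coefficients in $\{ -1,0,1\}$ whose support is a circuit (cocircuit). For $\vec P\in\mathbb Z^E$, $P$ is its support and $\vec P\setminus f$ is its restriction to $E\setminus\{f\}$. A fourientation is a map $\vec F$ from $E$ to the subsets of $\{+,-\}$ (written $\emptyset,+,-,\pm$); $-\vec F$ is obtained by swapping $+$ and $-$ pointwise, and $\vec F^c(x)=\{+,-\}\setminus\vec F(x)$. $\vec P\sim\vec F$ means that for every $x\in P$ the sign of $\vec P(x)$ lies in $\vec F(x)$. -}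

module Defs where

open import Data.Nat using (ℕ; zero; suc)
open import Data.Bool using (Bool; true; false; not)
open import Data.Fin using (Fin; zero; suc; toℕ; punchIn)
open import Data.Fin.Subset using (Subset; _∈_; _∉_; _⊆_; _∩_; Nonempty)
open import Data.Vec using (tabulate)
open import Data.Integer as ℤ using (ℤ; +_; -[1+_]; 0ℤ; 1ℤ; -1ℤ)
open import Data.Rational as ℚ using (ℚ; 0ℚ)
open import Data.Product using (Σ; _×_; ∃)
open import Data.Sum using (_⊎_)
open import Relation.Nullary using (¬_; does)
open import Relation.Binary.PropositionalEquality using (_≡_)
open import Function.Definitions using (Injective)

-- Matrices with m rows and columns indexed by E = Fin n.
Matrix : Set → ℕ → ℕ → Set
Matrix R m n = Fin m → Fin n → R

∑ℤ : ∀ k → (Fin k → ℤ) → ℤ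
∑ℤ zero    g = 0ℤ
∑ℤ (suc k) g = g zero ℤ.+ ∑ℤ k (λ i → g (suc i))

∑ℚ : ∀ k → (Fin k → ℚ) → ℚ
∑ℚ zero    g = 0ℚ
∑ℚ (suc k) g = g zero ℚ.+ ∑ℚ k (λ i → g (suc i))

alt : ℕ → ℤ
alt zero    = 1ℤ
alt (suc i) = ℤ.- alt i

det : ∀ k → (Fin k → Fin k → ℤ) → ℤ
det zero    M = 1ℤ
det (suc k) M =
  ∑ℤ (suc k) (λ j → alt (toℕ j) ℤ.* (M zero j ℤ.* det k (λ r c → M (suc r) (punchIn j c))))

TotallyUnimodular : ∀ {m n} → Matrix ℤ m n → Set
TotallyUnimodular {m} {n} A =
  ∀ k (r : Fin k → Fin m) (c : Fin k → Fin n) → Injective _≡_ _≡_ r → Injective _≡_ _≡_ c →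
    let d = det k (λ i j → A (r i) (c j)) in (d ≡ -1ℤ) ⊎ (d ≡ 0ℤ) ⊎ (d ≡ 1ℤ)

toℚ : ℤ → ℚ
toℚ z = z ℚ./ 1

FullRowRank : ∀ {m n} → Matrix ℤ m n → Set
FullRowRank {m} {n} A =
  ∀ (y : Fin m → ℚ) → (∀ j → ∑ℚ m (λ i → y i ℚ.* toℚ (A i j)) ≡ 0ℚ) → ∀ i → y i ≡ 0ℚ

Independent : ∀ {m n} → Matrix ℤ m n → Subset n → Set
Independent {m} {n} A S =
  ∀ (λ' : Fin n → ℚ) → (∀ j → j ∉ S → λ' j ≡ 0ℚ) →
    (∀ i → ∑ℚ n (λ j → toℚ (A i j) ℚ.* λ' j) ≡ 0ℚ) → ∀ j → λ' j ≡ 0ℚ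

IsBasis : ∀ {m n} → Matrix ℤ m n → Subset n → Set
IsBasis {m} {n} A B = Independent A B × (∀ S → B ⊆ S → Independent A S → S ⊆ B)

InSomeBasis : ∀ {m n} → Matrix ℤ m n → Subset n → Set
InSomeBasis A S = ∃ λ B → IsBasis A B × S ⊆ B

MeetsEveryBasis : ∀ {m n} → Matrix ℤ m n → Subset n → Set
MeetsEveryBasis A S = ∀ B → IsBasis A B → Nonempty (S ∩ B)

IsCircuit : ∀ {m n} → Matrix ℤ m n → Subset n → Set
IsCircuit A C = ¬ InSomeBasis A C × (∀ D → D ⊆ C → ¬ InSomeBasis A D → C ⊆ D)

IsCocircuit : ∀ {m n} → Matrix ℤ m n → Subset n → Set
IsCocircuit A C = MeetsEveryBasis A C × (∀ D → D ⊆ C → MeetsEveryBasis A D → C ⊆ D)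

supp : ∀ {n} → (Fin n → ℤ) → Subset n
supp P = tabulate (λ j → not (does (P j ℤ.≟ 0ℤ)))

Signed : ∀ {n} → (Fin n → ℤ) → Set
Signed P = ∀ j → (P j ≡ -1ℤ) ⊎ (P j ≡ 0ℤ) ⊎ (P j ≡ 1ℤ)

IsSignedCircuit : ∀ {m n} → Matrix ℤ m n → (Fin n → ℤ) → Set
IsSignedCircuit {m} {n} A P =
  Signed P × (∀ i → ∑ℚ n (λ j → toℚ (A i j) ℚ.* toℚ (P j)) ≡ 0ℚ) × IsCircuit A (supp P)

IsSignedCocircuit : ∀ {m n} → Matrix ℤ m n → (Fin n → ℤ) → Set
IsSignedCocircuit {m} {n} A P =
  Signed P × (∃ λ (y : Fin m → ℚ) → ∀ j → toℚ (P j) ≡ ∑ℚ m (λ i → y i ℚ.* toℚ (A i j)))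
  × IsCocircuit A (supp P)

-- Fourientations: each x ∈ E gets a subset of {+,-}.
data Sgn : Set where
  plus minus : Sgn

flipSgn : Sgn → Sgn
flipSgn plus  = minus
flipSgn minus = plus

Fourientation : ℕ → Set
Fourientation n = Fin n → Sgn → Bool

negF : ∀ {n} → Fourientation n → Fourientation n
negF F x s = F x (flipSgn s)

compF : ∀ {n} → Fourientation n → Fourientation n
compF F x s = not (F x s)

_∼_ : ∀ {n} → (Fin n → ℤ) → Fourientation n → Set
P ∼ F = ∀ x → x ∈ supp P →
  (ℤ.0ℤ ℤ.< P x → F x plus ≡ true) × (P x ℤ.< 0ℤ → F x minus ≡ true)

-- Restriction of P to E ∖ {f}, encoded as the vector on E that is 0 at f
-- (so its support is P ∖ {f}).
_∖_ : ∀ {n} → (Fin n → ℤ) → Fin n → (Fin n → ℤ)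
(P ∖ f) x with does (x Data.Fin.≟ f)
... | true  = 0ℤ
... | false = P x

-- Orthogonality of signed circuits and signed cocircuits gives ∑ⱼ C(j) C*(j) = 0, where every
-- term lies in {-1, 0, 1} and is nonzero exactly on C ∩ C*.  Off f the two sign conditions
-- forbid opposite signs, so every term other than the f-th is 0 or 1, and the e-th is 1.
-- The sum can only vanish if the f-th term is -1 and all terms other than those at e and f are 0.
module Submission where

open import Defs
open import Data.Nat using (zero; suc; s≤s; z≤n)
open import Data.Fin as Fin using (Fin; _≟_; punchIn; punchOut)
open import Data.Fin.Properties using (punchInᵢ≢i; punchIn-punchOut; punchOut-injective)
open import Data.Fin.Subset using (Subset; _∈_; _∉_; _∩_; _∪_; ⁅_⁆)
open import Data.Fin.Subset.Properties
  using (⊆-antisym; x∈p∩q⁺; x∈p∩q⁻; x∈p∪q⁺; x∈p∪q⁻; x∈⁅x⁆; x∈⁅y⁆⇒x≡y)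
open import Data.Integer as ℤ using (ℤ; 0ℤ; 1ℤ; -1ℤ)
open import Data.Rational as ℚ using (ℚ; 0ℚ; 1ℚ; _≤_)
import Data.Rational.Properties as ℚP
open import Data.Vec.Functional using (removeAt)
open import Data.Vec using (lookup)
open import Data.Vec.Properties using (lookup∘tabulate; lookup⇒[]=; []=⇒lookup)
open import Data.Bool using (true; not)
open import Data.Bool.Properties using (not-¬)
open import Data.Empty using (⊥-elim)
open import Data.Product using (_×_; _,_; proj₁; proj₂)
open import Data.Sum using (_⊎_; inj₁; inj₂)
open import Function using (_∘_)
open import Relation.Nullary using (¬_; yes; no; does)
open import Relation.Nullary.Decidable using (from-yes; from-no; dec-true; dec-false)
open import Relation.Binary.PropositionalEquality
  using (_≡_; _≢_; refl; sym; trans; cong; cong₂; subst₂; module ≡-Reasoning)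
open import Algebra.Bundles using (CommutativeRing; CommutativeMonoid)
open import Algebra.Properties.Semiring.Sum (CommutativeRing.semiring ℚP.+-*-commutativeRing)
  using (sum; sum-cong-≗; sum-remove; sum-replicate-zero; ∑-comm; *-distribˡ-sum)
open import Algebra.Properties.Monoid.Sum (CommutativeRing.+-monoid ℚP.+-*-commutativeRing)
  using (sum-syntax)
open import Algebra.Properties.CommutativeSemigroup
  (CommutativeMonoid.commutativeSemigroup ℚP.*-1-commutativeMonoid)
  using (x∙yz≈y∙zx)

∑ℚ≡sum : ∀ n (g : Fin n → ℚ) → ∑ℚ n g ≡ sum g
∑ℚ≡sum zero    g = refl
∑ℚ≡sum (suc n) g = cong (g Fin.zero ℚ.+_) (∑ℚ≡sum n (g ∘ Fin.suc))

kernel⊥rowSpace : ∀ {m n} (a : Fin m → Fin n → ℚ) (x : Fin n → ℚ) (d : Fin n → ℚ) (y : Fin m → ℚ) →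
  (∀ i → ∑ℚ n (λ j → a i j ℚ.* x j) ≡ 0ℚ) →
  (∀ j → d j ≡ ∑ℚ m (λ i → y i ℚ.* a i j)) →
  ∑ℚ n (λ j → x j ℚ.* d j) ≡ 0ℚ
kernel⊥rowSpace {m} {n} a x d y ax≡0 d≡yA = begin
  ∑ℚ n (λ j → x j ℚ.* d j)
    ≡⟨ ∑ℚ≡sum n _ ⟩
  ∑[ j < n ] (x j ℚ.* d j)
    ≡⟨ sum-cong-≗ (λ j → cong (x j ℚ.*_) (trans (d≡yA j) (∑ℚ≡sum m _))) ⟩
  ∑[ j < n ] (x j ℚ.* ∑[ i < m ] (y i ℚ.* a i j))
    ≡⟨ sum-cong-≗ (λ j → *-distribˡ-sum {m} (x j) _) ⟩
  ∑[ j < n ] ∑[ i < m ] (x j ℚ.* (y i ℚ.* a i j))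
    ≡⟨ ∑-comm (λ j i → x j ℚ.* (y i ℚ.* a i j)) ⟩
  ∑[ i < m ] ∑[ j < n ] (x j ℚ.* (y i ℚ.* a i j))
    ≡⟨ sum-cong-≗ (λ i → sum-cong-≗ (λ j → x∙yz≈y∙zx (x j) (y i) (a i j))) ⟩
  ∑[ i < m ] ∑[ j < n ] (y i ℚ.* (a i j ℚ.* x j))
    ≡⟨ sum-cong-≗ (λ i → sym (*-distribˡ-sum {n} (y i) _)) ⟩
  ∑[ i < m ] (y i ℚ.* ∑[ j < n ] (a i j ℚ.* x j))
    ≡⟨ sum-cong-≗ (λ i → cong (y i ℚ.*_) (trans (sym (∑ℚ≡sum n _)) (ax≡0 i))) ⟩
  ∑[ i < m ] (y i ℚ.* 0ℚ)
    ≡⟨ sum-cong-≗ (λ i → ℚP.*-zeroʳ (y i)) ⟩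
  ∑[ i < m ] 0ℚ
    ≡⟨ sum-replicate-zero m ⟩
  0ℚ ∎
  where open ≡-Reasoning

signedCircuit⊥signedCocircuit : ∀ {m n} (A : Matrix ℤ m n) {C D : Fin n → ℤ} →
  IsSignedCircuit A C → IsSignedCocircuit A D →
  ∑ℚ n (λ j → toℚ (C j) ℚ.* toℚ (D j)) ≡ 0ℚ
signedCircuit⊥signedCocircuit A {C} {D} (_ , AC≡0 , _) (_ , (y , D≡yA) , _) =
  kernel⊥rowSpace (λ i j → toℚ (A i j)) (toℚ ∘ C) (toℚ ∘ D) y AC≡0 D≡yA

-1ℚ : ℚ
-1ℚ = ℚ.- 1ℚ

IsSignℤ : ℤ → Set
IsSignℤ z = z ≡ -1ℤ ⊎ z ≡ 0ℤ ⊎ z ≡ 1ℤ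

IsSignℚ : ℚ → Set
IsSignℚ q = q ≡ -1ℚ ⊎ q ≡ 0ℚ ⊎ q ≡ 1ℚ

Opposite : ℤ → ℤ → Set
Opposite a b = (a ≡ 1ℤ × b ≡ -1ℤ) ⊎ (a ≡ -1ℤ × b ≡ 1ℤ)

sign-* : ∀ {a b} → IsSignℤ a → IsSignℤ b → IsSignℚ (toℚ a ℚ.* toℚ b)
sign-*         (inj₁ refl)        (inj₁ refl)        = inj₂ (inj₂ refl)
sign-*         (inj₁ refl)        (inj₂ (inj₁ refl)) = inj₂ (inj₁ refl)
sign-*         (inj₁ refl)        (inj₂ (inj₂ refl)) = inj₁ refl
sign-* {b = b} (inj₂ (inj₁ refl)) _                  = inj₂ (inj₁ (ℚP.*-zeroˡ (toℚ b)))
sign-*         (inj₂ (inj₂ refl)) (inj₁ refl)        = inj₁ refl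
sign-*         (inj₂ (inj₂ refl)) (inj₂ (inj₁ refl)) = inj₂ (inj₁ refl)
sign-*         (inj₂ (inj₂ refl)) (inj₂ (inj₂ refl)) = inj₂ (inj₂ refl)

sign-*≡-1⇒opposite : ∀ {a b} → IsSignℤ a → IsSignℤ b → toℚ a ℚ.* toℚ b ≡ -1ℚ → Opposite a b
sign-*≡-1⇒opposite (inj₁ refl)        (inj₂ (inj₂ refl)) _  = inj₂ (refl , refl)
sign-*≡-1⇒opposite (inj₂ (inj₂ refl)) (inj₁ refl)        _  = inj₁ (refl , refl)
sign-*≡-1⇒opposite (inj₁ refl)        (inj₁ refl)        ()
sign-*≡-1⇒opposite (inj₁ refl)        (inj₂ (inj₁ refl)) ()
sign-*≡-1⇒opposite (inj₂ (inj₁ refl)) (inj₁ refl)        ()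
sign-*≡-1⇒opposite (inj₂ (inj₁ refl)) (inj₂ (inj₁ refl)) ()
sign-*≡-1⇒opposite (inj₂ (inj₁ refl)) (inj₂ (inj₂ refl)) ()
sign-*≡-1⇒opposite (inj₂ (inj₂ refl)) (inj₂ (inj₁ refl)) ()
sign-*≡-1⇒opposite (inj₂ (inj₂ refl)) (inj₂ (inj₂ refl)) ()

sign-*≡0⇒ : ∀ {a b} → IsSignℤ a → IsSignℤ b → toℚ a ℚ.* toℚ b ≡ 0ℚ → a ≡ 0ℤ ⊎ b ≡ 0ℤ
sign-*≡0⇒ (inj₂ (inj₁ refl)) _                  _  = inj₁ refl
sign-*≡0⇒ _                  (inj₂ (inj₁ refl)) _  = inj₂ refl
sign-*≡0⇒ (inj₁ refl)        (inj₁ refl)        ()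
sign-*≡0⇒ (inj₁ refl)        (inj₂ (inj₂ refl)) ()
sign-*≡0⇒ (inj₂ (inj₂ refl)) (inj₁ refl)        ()
sign-*≡0⇒ (inj₂ (inj₂ refl)) (inj₂ (inj₂ refl)) ()

sum-nonneg : ∀ {n} (u : Fin n → ℚ) → (∀ k → 0ℚ ≤ u k) → 0ℚ ≤ ∑[ k < n ] u k
sum-nonneg {zero}  u u≥0 = ℚP.≤-refl
sum-nonneg {suc n} u u≥0 =
  subst₂ _≤_ (ℚP.+-identityˡ 0ℚ) refl
    (ℚP.+-mono-≤ (u≥0 Fin.zero) (sum-nonneg (u ∘ Fin.suc) (u≥0 ∘ Fin.suc)))

≤-sum : ∀ {n} (u : Fin n → ℚ) → (∀ k → 0ℚ ≤ u k) → ∀ i → u i ≤ ∑[ k < n ] u k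
≤-sum {suc n} u u≥0 i = begin
  u i                          ≡⟨ ℚP.+-identityʳ (u i) ⟨
  u i ℚ.+ 0ℚ                   ≤⟨ ℚP.+-monoʳ-≤ (u i) (sum-nonneg (removeAt u i) (u≥0 ∘ punchIn i)) ⟩
  u i ℚ.+ sum (removeAt u i)   ≡⟨ sum-remove u ⟨
  sum u                        ∎
  where open ℚP.≤-Reasoning

pair≤sum : ∀ {n} (u : Fin n → ℚ) → (∀ k → 0ℚ ≤ u k) → ∀ {i j} → i ≢ j →
  u i ℚ.+ u j ≤ ∑[ k < n ] u k
pair≤sum {suc n} u u≥0 {i} {j} i≢j = begin
  u i ℚ.+ u j                  ≡⟨ cong (λ k → u i ℚ.+ u k) (punchIn-punchOut i≢j) ⟨
  u i ℚ.+ removeAt u i j′      ≤⟨ ℚP.+-monoʳ-≤ (u i) (≤-sum (removeAt u i) (u≥0 ∘ punchIn i) j′) ⟩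
  u i ℚ.+ sum (removeAt u i)   ≡⟨ sum-remove u ⟨
  sum u                        ∎
  where
  open ℚP.≤-Reasoning
  j′ = punchOut i≢j

nonneg-sign : ∀ {q} → q ≡ 0ℚ ⊎ q ≡ 1ℚ → 0ℚ ≤ q
nonneg-sign (inj₁ refl) = ℚP.≤-refl
nonneg-sign (inj₂ refl) = from-yes (0ℚ ℚP.≤? 1ℚ)

1≰0 : ¬ 1ℚ ≤ 0ℚ
1≰0 = from-no (1ℚ ℚP.≤? 0ℚ)

zero-sum-of-signs : ∀ {n} (t : Fin n → ℚ) {e f : Fin n} → e ≢ f →
  (∀ j → IsSignℚ (t j)) → (∀ j → j ≢ f → t j ≢ -1ℚ) → t e ≢ 0ℚ → ∑[ j < n ] t j ≡ 0ℚ →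
  t f ≡ -1ℚ × (∀ j → j ≢ e → j ≢ f → t j ≡ 0ℚ)
zero-sum-of-signs {suc n} t {e} {f} e≢f sign t≢-1 te≢0 ∑t≡0 = tf≡-1 , others≡0
  where
  open ℚP.≤-Reasoning

  u : Fin n → ℚ
  u = removeAt t f

  u≥0 : ∀ k → 0ℚ ≤ u k
  u≥0 k with sign (punchIn f k)
  ... | inj₁ ≡-1   = ⊥-elim (t≢-1 (punchIn f k) (punchInᵢ≢i f k) ≡-1)
  ... | inj₂ ≡0or1 = nonneg-sign ≡0or1

  index-in-u : ∀ {j} → j ≢ f → Fin n
  index-in-u j≢f = punchOut (j≢f ∘ sym)

  t≡u : ∀ {j} (j≢f : j ≢ f) → t j ≡ u (index-in-u j≢f)
  t≡u j≢f = cong t (sym (punchIn-punchOut (j≢f ∘ sym)))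

  tf+∑u≡0 : t f ℚ.+ sum u ≡ 0ℚ
  tf+∑u≡0 = trans (sym (sum-remove t)) ∑t≡0

  te≡1 : t e ≡ 1ℚ
  te≡1 with sign e
  ... | inj₁ te≡-1        = ⊥-elim (t≢-1 e e≢f te≡-1)
  ... | inj₂ (inj₁ te≡0)  = ⊥-elim (te≢0 te≡0)
  ... | inj₂ (inj₂ te≡1′) = te≡1′

  tf≱0 : ¬ 0ℚ ≤ t f
  tf≱0 tf≥0 = 1≰0 (begin
    0ℚ ℚ.+ 1ℚ                 ≡⟨ cong (0ℚ ℚ.+_) (trans (sym (t≡u e≢f)) te≡1) ⟨
    0ℚ ℚ.+ u (index-in-u e≢f) ≤⟨ ℚP.+-mono-≤ tf≥0 (≤-sum u u≥0 (index-in-u e≢f)) ⟩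
    t f ℚ.+ sum u             ≡⟨ tf+∑u≡0 ⟩
    0ℚ                        ∎)

  tf≡-1 : t f ≡ -1ℚ
  tf≡-1 with sign f
  ... | inj₁ tf≡-1′ = tf≡-1′
  ... | inj₂ ≡0or1  = ⊥-elim (tf≱0 (nonneg-sign ≡0or1))

  others≡0 : ∀ j → j ≢ e → j ≢ f → t j ≡ 0ℚ
  others≡0 j j≢e j≢f with sign j
  ... | inj₁ tj≡-1       = ⊥-elim (t≢-1 j j≢f tj≡-1)
  ... | inj₂ (inj₁ tj≡0) = tj≡0
  ... | inj₂ (inj₂ tj≡1) = ⊥-elim (1≰0 (begin
    -1ℚ ℚ.+ (1ℚ ℚ.+ 1ℚ)
      ≡⟨ cong₂ ℚ._+_ tf≡-1 (cong₂ ℚ._+_ (trans (sym (t≡u e≢f)) te≡1) (trans (sym (t≡u j≢f)) tj≡1)) ⟨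
    t f ℚ.+ (u (index-in-u e≢f) ℚ.+ u (index-in-u j≢f))
      ≤⟨ ℚP.+-monoʳ-≤ (t f) (pair≤sum u u≥0 (j≢e ∘ sym ∘ punchOut-injective (e≢f ∘ sym) (j≢f ∘ sym))) ⟩
    t f ℚ.+ sum u
      ≡⟨ tf+∑u≡0 ⟩
    0ℚ ∎))

∈supp : ∀ {n} (P : Fin n → ℤ) {j} → P j ≢ 0ℤ → j ∈ supp P
∈supp P {j} Pj≢0 =
  lookup⇒[]= j (supp P) (trans (lookup∘tabulate _ j) (cong not (dec-false (P j ℤ.≟ 0ℤ) Pj≢0)))

∈supp⇒≢0 : ∀ {n} (P : Fin n → ℤ) {j} → j ∈ supp P → P j ≢ 0ℤ
∈supp⇒≢0 P {j} j∈P Pj≡0 = not-¬ refl (begin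
  true                       ≡⟨ []=⇒lookup j∈P ⟨
  lookup (supp P) j          ≡⟨ lookup∘tabulate _ j ⟩
  not (does (P j ℤ.≟ 0ℤ))    ≡⟨ cong not (dec-true (P j ℤ.≟ 0ℤ) Pj≡0) ⟩
  not true                   ∎)
  where open ≡-Reasoning

∈supp∩supp⇒*≢0 : ∀ {n} (P Q : Fin n → ℤ) {x} → IsSignℤ (P x) → IsSignℤ (Q x) →
  x ∈ supp P ∩ supp Q → toℚ (P x) ℚ.* toℚ (Q x) ≢ 0ℚ
∈supp∩supp⇒*≢0 P Q Px-sign Qx-sign x∈P∩Q PQx≡0
  with x∈p∩q⁻ (supp P) (supp Q) x∈P∩Q | sign-*≡0⇒ Px-sign Qx-sign PQx≡0
... | x∈P , _ | inj₁ Px≡0 = ∈supp⇒≢0 P x∈P Px≡0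
... | _ , x∈Q | inj₂ Qx≡0 = ∈supp⇒≢0 Q x∈Q Qx≡0

*≢0⇒∈supp∩supp : ∀ {n} (P Q : Fin n → ℤ) {x} →
  toℚ (P x) ℚ.* toℚ (Q x) ≢ 0ℚ → x ∈ supp P ∩ supp Q
*≢0⇒∈supp∩supp P Q {x} PQx≢0 = x∈p∩q⁺ (∈supp P Px≢0 , ∈supp Q Qx≢0)
  where
  Px≢0 : P x ≢ 0ℤ
  Px≢0 Px≡0 = PQx≢0 (trans (cong (λ z → toℚ z ℚ.* toℚ (Q x)) Px≡0) (ℚP.*-zeroˡ (toℚ (Q x))))
  Qx≢0 : Q x ≢ 0ℤ
  Qx≢0 Qx≡0 = PQx≢0 (trans (cong (λ z → toℚ (P x) ℚ.* toℚ z) Qx≡0) (ℚP.*-zeroʳ (toℚ (P x))))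

p≡⁅x⁆∪⁅y⁆ : ∀ {n} {p : Subset n} {x y} → x ∈ p → y ∈ p → (∀ {z} → z ≢ x → z ≢ y → z ∉ p) →
  p ≡ ⁅ x ⁆ ∪ ⁅ y ⁆
p≡⁅x⁆∪⁅y⁆ {p = p} {x} {y} x∈p y∈p only-x-y = ⊆-antisym p⊆ ⊆p
  where
  p⊆ : ∀ {z} → z ∈ p → z ∈ ⁅ x ⁆ ∪ ⁅ y ⁆
  p⊆ {z} z∈p with z ≟ x | z ≟ y
  ... | yes refl | _        = x∈p∪q⁺ (inj₁ (x∈⁅x⁆ z))
  ... | no _     | yes refl = x∈p∪q⁺ (inj₂ (x∈⁅x⁆ z))
  ... | no z≢x   | no z≢y   = ⊥-elim (only-x-y z≢x z≢y z∈p)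
  ⊆p : ∀ {z} → z ∈ ⁅ x ⁆ ∪ ⁅ y ⁆ → z ∈ p
  ⊆p {z} z∈xy with x∈p∪q⁻ ⁅ x ⁆ ⁅ y ⁆ z∈xy
  ... | inj₁ z∈x rewrite x∈⁅y⁆⇒x≡y x z∈x = x∈p
  ... | inj₂ z∈y rewrite x∈⁅y⁆⇒x≡y y z∈y = y∈p

∖-≢ : ∀ {n} (P : Fin n → ℤ) {f x} → x ≢ f → (P ∖ f) x ≡ P x
∖-≢ P {f} {x} x≢f with x ≟ f
... | yes x≡f = ⊥-elim (x≢f x≡f)
... | no _    = refl

∼-plus : ∀ {n} {P : Fin n → ℤ} {F x} → P ∼ F → P x ≡ 1ℤ → F x plus ≡ true
∼-plus {P = P} {x = x} P∼F Px≡1 =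
  proj₁ (P∼F x (∈supp P (λ Px≡0 → 1ℤ≢0ℤ (trans (sym Px≡1) Px≡0))))
        (subst₂ ℤ._<_ refl (sym Px≡1) (ℤ.+<+ (s≤s z≤n)))
  where
  1ℤ≢0ℤ : 1ℤ ≢ 0ℤ
  1ℤ≢0ℤ ()

∼-minus : ∀ {n} {P : Fin n → ℤ} {F x} → P ∼ F → P x ≡ -1ℤ → F x minus ≡ true
∼-minus {P = P} {x = x} P∼F Px≡-1 =
  proj₂ (P∼F x (∈supp P (λ Px≡0 → -1ℤ≢0ℤ (trans (sym Px≡-1) Px≡0))))
        (subst₂ ℤ._<_ (sym Px≡-1) refl ℤ.-<+)
  where
  -1ℤ≢0ℤ : -1ℤ ≢ 0ℤ
  -1ℤ≢0ℤ ()

∼-¬opposite : ∀ {n} {P Q : Fin n → ℤ} {F} → P ∼ F → Q ∼ compF (negF F) → ∀ x → ¬ Opposite (P x) (Q x)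
∼-¬opposite {F = F} P∼F Q∼F′ x (inj₁ (Px≡1 , Qx≡-1)) =
  not-¬ refl (trans (∼-plus {F = F} P∼F Px≡1) (sym (∼-minus {F = compF (negF F)} Q∼F′ Qx≡-1)))
∼-¬opposite {F = F} P∼F Q∼F′ x (inj₂ (Px≡-1 , Qx≡1)) =
  not-¬ refl (trans (∼-minus {F = F} P∼F Px≡-1) (sym (∼-plus {F = compF (negF F)} Q∼F′ Qx≡1)))

∖-∼-*≢-1 : ∀ {n} {P Q : Fin n → ℤ} {F f x} → (P ∖ f) ∼ F → (Q ∖ f) ∼ compF (negF F) →
  IsSignℤ (P x) → IsSignℤ (Q x) → x ≢ f → toℚ (P x) ℚ.* toℚ (Q x) ≢ -1ℚ
∖-∼-*≢-1 {P = P} {Q} {F} {x = x} P∖f∼F Q∖f∼-Fᶜ Px-sign Qx-sign x≢f PQx≡-1 =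
  ∼-¬opposite {F = F} P∖f∼F Q∖f∼-Fᶜ x
    (subst₂ Opposite (sym (∖-≢ P x≢f)) (sym (∖-≢ Q x≢f))
      (sign-*≡-1⇒opposite Px-sign Qx-sign PQx≡-1))

lemma3p4 : ∀ {m n} (A : Matrix ℤ m n) → TotallyUnimodular A → FullRowRank A →
    (e f : Fin n) → e ≢ f →
    (C C* : Fin n → ℤ) → IsSignedCircuit A C → IsSignedCocircuit A C* →
    (F : Fourientation n) →
    e ∈ (supp C ∩ supp C*) →
    (C ∖ f) ∼ F →
    (C* ∖ f) ∼ compF (negF F) →
    supp C ∩ supp C* ≡ ⁅ e ⁆ ∪ ⁅ f ⁆
lemma3p4 {n = n} A _ _ e f e≢f C C* C-circuit C*-cocircuit F e∈C∩C* C∖f∼F C*∖f∼-Fᶜ =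
  p≡⁅x⁆∪⁅y⁆ e∈C∩C* (*≢0⇒∈supp∩supp C C* tf≢0) only-e-f
  where
  C-sign : Signed C
  C-sign = proj₁ C-circuit

  C*-sign : Signed C*
  C*-sign = proj₁ C*-cocircuit

  t : Fin n → ℚ
  t j = toℚ (C j) ℚ.* toℚ (C* j)

  zero-sum : t f ≡ -1ℚ × (∀ j → j ≢ e → j ≢ f → t j ≡ 0ℚ)
  zero-sum =
    zero-sum-of-signs t e≢f (λ j → sign-* (C-sign j) (C*-sign j))
      (λ j → ∖-∼-*≢-1 {F = F} C∖f∼F C*∖f∼-Fᶜ (C-sign j) (C*-sign j))
      (∈supp∩supp⇒*≢0 C C* (C-sign e) (C*-sign e) e∈C∩C*)
      (trans (sym (∑ℚ≡sum n t)) (signedCircuit⊥signedCocircuit A C-circuit C*-cocircuit))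

  only-e-f : ∀ {x} → x ≢ e → x ≢ f → x ∉ supp C ∩ supp C*
  only-e-f {x} x≢e x≢f x∈C∩C* =
    ∈supp∩supp⇒*≢0 C C* (C-sign x) (C*-sign x) x∈C∩C* (proj₂ zero-sum x x≢e x≢f)

  tf≢0 : t f ≢ 0ℚ
  tf≢0 tf≡0 = -1ℚ≢0ℚ (trans (sym (proj₁ zero-sum)) tf≡0)
    where
    -1ℚ≢0ℚ : -1ℚ ≢ 0ℚ
    -1ℚ≢0ℚ ()
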